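{- Let $n\ge 1$ and $e\ge 1$ be integers, let $R_n$ be the $n\times n$ matrix whose $(i,j)$ entry is $\binom{i-1}{n-j}$, and write $a_{i,j}^{(e)}$ for the $(i,j)$ entry of $R_n^e$. Then for every $1\le i\le n$, \[ \sum_{j=1}^{n} a_{i,j}^{(e)}\,x^{j-1}=(F_e+F_{e+1}x)^{i-1}(F_{e-1}+F_e x)^{n-i} \] as polynomials in $x$. Moreover, extend the array $(a^{(e)}_{i,j})$ to all rows $i\ge 1$ (keeping $1\le j\le n$) as follows. For $e=1$, set $a^{(1)}_{i,j}=\binom{i-1}{n-j}$ for all $i\ge1$, $1\le j\le n$. For $e\ge 2$, set $a^{(e)}_{1,j}=\binom{n-1}{j-1}F_{e-1}^{n-j}F_e^{j-1}$ for $1\le j\le n$, $a^{(e)}_{i,1}=F_{e-1}^{n-i}F_e^{i-1}$ for all $i\ge 1$, and for $i\ge 2$, $2\le j\le n$ define recursively \[ F_{e-1}a^{(e)}_{i,j}=F_e a^{(e)}_{i-1,j}+F_{e+1}a^{(e)}_{i-1,j-1}-F_e a^{(e)}_{i,j-1}. \] (For $1\le i\le n$ these values coincide with the entries of $R_n^e$.) Let $c_j^{(e)}(x)=\sum_{i\ge 1}a^{(e)}_{i,j}x^{i-1}$ (formal power series). Then $c_j^{(1)}(x)=(1-x)^{j-1-n}x^{n-j}$, and for $e>1$ and $1\le j\le n$, \[ c_j^{(e)}(x)=\left(\frac{F_{e+1}x-F_e}{F_{e-1}-F_e x}\right)^{j-1}\frac{F_{e-1}^n}{F_{e-1}-F_e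 x}\left[1+\sum_{s=1}^{j-1}\binom{n}{s}\left(\frac{F_e(F_{e-1}-F_e x)}{F_{e-1}(F_{e+1}x-F_e)}\right)^s\right]. \]
   Context: $F_m$ denotes the Fibonacci sequence, $F_0=0$, $F_1=1$, $F_{m+1}=F_m+F_{m-1}$, extended so that $F_{ -1}=1$. Binomial coefficients $\binom{a}{b}$ are $0$ when $b<0$ or $b>a$ (for $a\ge 0$). Rational functions in the column formula are interpreted as formal power series in $x$ (all denominators have nonzero constant term when $e\ge2$). -}

module Defs where

open import Data.Nat as ℕ using (ℕ; zero; suc; _∸_; _≤ᵇ_)
open import Data.Nat.Combinatorics using (_C_)
open import Data.Integer as ℤ using (ℤ)
open import Data.Rational using (ℚ; 0ℚ; 1ℚ; _+_; _*_; _-_; -_; 1/_; ≢-nonZero; _/_)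
open import Data.Rational.Properties using (_≟_)
open import Data.Fin using (Fin; toℕ)
open import Data.List using (List; []; _∷_; map; foldr; zipWith; upTo)
open import Data.Bool using (if_then_else_)
open import Relation.Nullary using (yes; no)
open import Relation.Binary.PropositionalEquality using (_≡_)

fib : ℕ → ℕ
fib zero = 0
fib (suc zero) = 1
fib (suc (suc m)) = fib (suc m) ℕ.+ fib m

ℕ→ℚ : ℕ → ℚ
ℕ→ℚ n = ℤ.+ n / 1

-- reciprocal, totalised by 1/0 := 0 (only ever applied to nonzero values
-- in the statement)
recip : ℚ → ℚ
recip q with q ≟ 0ℚ
... | yes _ = 0ℚ
... | no q≢0 = 1/_ q {{≢-nonZero q≢0}}

_^ℚ_ : ℚ → ℕ → ℚ
q ^ℚ zero = 1ℚ
q ^ℚ suc k = q * (q ^ℚ k)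

-- integer power q^(a - b) with a, b natural (negative exponents via recip)
zpow : ℚ → ℕ → ℕ → ℚ
zpow q a b = if b ≤ᵇ a then q ^ℚ (a ∸ b) else recip q ^ℚ (b ∸ a)

sumℚ : List ℚ → ℚ
sumℚ = foldr _+_ 0ℚ

Series : Set
Series = ℕ → ℚ

_≈ₛ_ : Series → Series → Set
f ≈ₛ g = ∀ k → f k ≡ g k

zeroS : Series
zeroS _ = 0ℚ

constS : ℚ → Series
constS c zero = c
constS c (suc _) = 0ℚ

oneS : Series
oneS = constS 1ℚ

monoS : ℕ → Series
monoS zero = oneS
monoS (suc m) zero = 0ℚ
monoS (suc m) (suc k) = monoS m k

linS : ℚ → ℚ → Series
linS a b zero = a
linS a b (suc zero) = b
linS a b (suc (suc _)) = 0ℚ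

_⊕_ : Series → Series → Series
(f ⊕ g) k = f k + g k

scaleS : ℚ → Series → Series
scaleS c f k = c * f k

_⊛_ : Series → Series → Series
(f ⊛ g) k = sumℚ (map (λ l → f l * g (k ∸ l)) (upTo (suc k)))

infixl 7 _⊛_
infixl 6 _⊕_

powS : Series → ℕ → Series
powS f zero = oneS
powS f (suc m) = f ⊛ powS f m

-- multiplicative inverse of a series with nonzero constant term:
-- g_0 = 1/f_0,  g_k = -(1/f_0) Σ_{l=1}^{k} f_l g_{k-l}.
-- invList f k = [g_k, g_{k-1}, ..., g_0]
invList : Series → ℕ → List ℚ
invList f zero = recip (f 0) ∷ []
invList f (suc k) =
  (- (recip (f 0) * sumℚ (zipWith _*_ (map (λ l → f (suc l)) (upTo (suc k))) prev)))
  ∷ prev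
  where
  prev = invList f k

invS : Series → Series
invS f k with invList f k
... | [] = 0ℚ
... | g ∷ _ = g

sumS1 : ℕ → (ℕ → Series) → Series
sumS1 zero h = zeroS
sumS1 (suc m) h = sumS1 m h ⊕ h (suc m)

Mat : ℕ → Set
Mat n = Fin n → Fin n → ℕ

sumFin : ∀ {n} → (Fin n → ℕ) → ℕ
sumFin {zero} f = 0
sumFin {suc n} f = f Fin.zero ℕ.+ sumFin (λ i → f (Fin.suc i))
  where import Data.Fin as Fin

sumFinS : ∀ {n} → (Fin n → Series) → Series
sumFinS {zero} f = zeroS
sumFinS {suc n} f = f Fin.zero ⊕ sumFinS (λ i → f (Fin.suc i))
  where import Data.Fin as Fin

_⊗_ : ∀ {n} → Mat n → Mat n → Mat n
(A ⊗ B) i j = sumFin (λ k → A i k ℕ.* B k j)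

idMat : ∀ {n} → Mat n
idMat i j with toℕ i ℕ.≟ toℕ j
... | yes _ = 1
... | no _ = 0

matPow : ∀ {n} → Mat n → ℕ → Mat n
matPow A zero = idMat
matPow A (suc e) = A ⊗ matPow A e

-- R_n: (i,j) entry (1-based) is binom(i-1, n-j); with 0-based Fin indices
-- i' = i-1, j' = j-1 this is binom(i', n-1-j') = binom(i', n - (j'+1)).
Rmat : (n : ℕ) → Mat n
Rmat n i j = toℕ i C (n ∸ suc (toℕ j))

-- the recursion for e ≥ 2, with 0-based indices i' = i-1, j' = j-1
arrRec : (n e : ℕ) → ℕ → ℕ → ℚ
arrRec n e zero j =
  -- a_{1,j} = binom(n-1, j-1) F_{e-1}^{n-j} F_e^{j-1}
  ℕ→ℚ ((n ∸ 1) C j) * (ℕ→ℚ (fib (e ∸ 1)) ^ℚ (n ∸ suc j)) * (ℕ→ℚ (fib e) ^ℚ j)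
arrRec n e (suc i) zero =
  -- a_{i,1} = F_{e-1}^{n-i} F_e^{i-1}, here i = i'+1 = suc i + 1 (exponent may be negative)
  zpow (ℕ→ℚ (fib (e ∸ 1))) n (suc (suc i)) * (ℕ→ℚ (fib e) ^ℚ suc i)
arrRec n e (suc i) (suc j) =
  -- F_{e-1} a_{i,j} = F_e a_{i-1,j} + F_{e+1} a_{i-1,j-1} - F_e a_{i,j-1}
  recip (ℕ→ℚ (fib (e ∸ 1))) *
    (ℕ→ℚ (fib e) * arrRec n e i (suc j)
     + ℕ→ℚ (fib (suc e)) * arrRec n e i j
     - ℕ→ℚ (fib e) * arrRec n e (suc i) j)

-- a^{(e)}_{i,j} with 1-based indices (values at i = 0 or j = 0 are junk)
arr : (n e i j : ℕ) → ℚ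
arr n (suc zero) i j = ℕ→ℚ ((i ∸ 1) C (n ∸ j))
arr n e i j = arrRec n e (i ∸ 1) (j ∸ 1)

col : (n e j : ℕ) → Series
col n e j k = arr n e (suc k) j

{-# OPTIONS --safe #-}

-- Read row i of a matrix M as the polynomial Σ_j M_ij x^j. Row i of R_n M is then
-- Σ_k C(i, n-1-k) · (row k of M); if row k of M is U^k V^(n-1-k) for every k, the binomial theorem
-- turns this into (U + V)^i U^(n-1-i). Starting from the identity matrix, (U, V) = (x, 1), each
-- step maps (F_e + F_{e+1} x, F_{e-1} + F_e x) to the same pair for e + 1, giving the rows of R_n^e.
--
-- For e ≥ 2 let a, b, c = F_{e-1}, F_e, F_{e+1}. The recursion of the extended array,
-- a A(i+1,j+1) + b A(i+1,j) = b A(i,j+1) + c A(i,j), also holds for j = 0 if A(i,0) = 0 (that is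
-- the first column). Read along rows it says (a + b x) row_{i+1} = (b + c x) row_i, which the
-- products (b + c x)^i (a + b x)^(n-1-i) satisfy as well, so the array agrees with R_n^e for i ≤ n.
-- Read along columns it says (a - b x) c_{j+1} = (-b + c x) c_j + C(n,j) a^(n-j) b^j, with
-- (a - b x) c_1 = a^n, and unrolling this first-order recursion gives the closed form. For e = 1,
-- Pascal's rule gives (1 - x) c_{r+1} = x c_r for the series c_r = Σ_k C(k,r) x^k, so
-- c_r = x^r / (1 - x)^(r+1).

module Submission where

open import Defs
open import Data.Nat as ℕ using (ℕ; zero; suc; _∸_; _≤_; _<_; s≤s; z≤n)
import Data.Nat.Properties as ℕ
open import Data.Nat.Combinatorics using (_C_; nCk≡nC[n∸k]; nCk+nC[k+1]≡[n+1]C[k+1])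
open import Data.Nat.Combinatorics.Specification using (k>n⇒nCk≡0)
open import Data.Fin using (Fin; toℕ)
import Data.Fin as Fin
import Data.Fin.Properties as Fin
open import Data.Vec.Functional using (Vector)
open import Function using (_∘_)
open import Relation.Binary.PropositionalEquality using (_≡_; _≢_; subst)
import Relation.Binary.PropositionalEquality as ≡
open import Relation.Nullary using (yes; no)
open import Data.Empty using (⊥-elim)
open import Algebra.Bundles using (Monoid; CommutativeSemiring; CommutativeRing)
import Algebra.Construct.Pointwise as Pointwise
open import Algebra.Properties.Monoid.Sum ℕ.+-0-monoid using () renaming (sum to sumℕ)

idMat-diagonal : ∀ {n} (i : Fin n) → idMat i i ≡ 1
idMat-diagonal i with toℕ i ℕ.≟ toℕ i
... | yes _ = ≡.refl
... | no i≢i = ⊥-elim (i≢i ≡.refl)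

idMat-offDiagonal : ∀ {n} {i j : Fin n} → i ≢ j → idMat i j ≡ 0
idMat-offDiagonal {i = i} {j} i≢j with toℕ i ℕ.≟ toℕ j
... | yes i≡j = ⊥-elim (i≢j (Fin.toℕ-injective i≡j))
... | no _ = ≡.refl

module _ {c ℓ} (M : Monoid c ℓ) where
  open Monoid M
  open import Algebra.Properties.Monoid.Sum M using (sum; sum-cong-≋; sum-replicate-zero)

  sum-concentrated : ∀ {n} (t : Vector Carrier n) i → (∀ j → j ≢ i → t j ≈ ε) → sum t ≈ t i
  sum-concentrated {suc n} t Fin.zero t≈ε =
    trans (∙-congˡ (trans (sum-cong-≋ (λ j → t≈ε (Fin.suc j) λ ())) (sum-replicate-zero n)))
          (identityʳ (t Fin.zero))
  sum-concentrated t (Fin.suc i) t≈ε =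
    trans (∙-cong (t≈ε Fin.zero λ ()) (sum-concentrated (t ∘ Fin.suc) i
                                         (λ j j≢i → t≈ε (Fin.suc j) (j≢i ∘ Fin.suc-injective))))
          (identityˡ (t (Fin.suc i)))

-- Rows of powers of R_n

module RowPolynomials {c ℓ} (S : CommutativeSemiring c ℓ) where
  open CommutativeSemiring S
  open import Algebra.Properties.Semiring.Mult semiring
    using (_×_; ×-homo-0; ×-homo-1; ×-homo-+; ×-assocˡ; ×-assoc-*; ×-comm-*; ×-congʳ; ×-congˡ)
  open import Algebra.Properties.Semiring.Exp semiring using (_^_; ^-congˡ)
  open import Algebra.Properties.Semiring.Sum semiring
    using (sum; sum-syntax; sum-cong-≋; ∑-comm; *-distribˡ-sum)
  import Algebra.Properties.CommutativeSemiring.Binomial S as Binomial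
  open import Algebra.Properties.CommutativeSemigroup +-commutativeSemigroup using (interchange)
  open import Algebra.Properties.CommutativeSemigroup *-commutativeSemigroup using (x∙yz≈y∙xz)
  open import Relation.Binary.Reasoning.Setoid setoid

  row : ∀ {n} → (Fin n → ℕ) → Carrier → Carrier
  row v x = sum (λ j → v j × x ^ toℕ j)

  ×≈×1#* : ∀ m y → m × y ≈ (m × 1#) * y
  ×≈×1#* m y = sym (trans (×-assoc-* m 1# y) (×-congʳ m (*-identityˡ y)))

  ×-distrib-sum : ∀ {n} m (ys : Vector Carrier n) → m × sum ys ≈ sum (λ k → m × ys k)
  ×-distrib-sum m ys = begin
    m × sum ys                  ≈⟨ ×≈×1#* m (sum ys) ⟩
    (m × 1#) * sum ys           ≈⟨ *-distribˡ-sum (m × 1#) ys ⟩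
    sum (λ k → (m × 1#) * ys k) ≈⟨ sum-cong-≋ (λ k → sym (×≈×1#* m (ys k))) ⟩
    sum (λ k → m × ys k)        ∎

  sumFin-× : ∀ {n} (f : Fin n → ℕ) y → sumFin f × y ≈ sum (λ k → f k × y)
  sumFin-× {zero} f y = refl
  sumFin-× {suc n} f y = trans (×-homo-+ y (f Fin.zero) (sumFin (f ∘ Fin.suc)))
                               (+-congˡ (sumFin-× (f ∘ Fin.suc) y))

  row-⊗ : ∀ {n} (A M : Mat n) i x → row ((A ⊗ M) i) x ≈ sum (λ k → A i k × row (M k) x)
  row-⊗ A M i x = begin
    sum (λ j → sumFin (λ k → A i k ℕ.* M k j) × x ^ toℕ j)
      ≈⟨ sum-cong-≋ (λ j → sumFin-× (λ k → A i k ℕ.* M k j) (x ^ toℕ j)) ⟩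
    sum (λ j → sum (λ k → (A i k ℕ.* M k j) × x ^ toℕ j))
      ≈⟨ sum-cong-≋ (λ j → sum-cong-≋ (λ k → sym (×-assocˡ (x ^ toℕ j) (A i k) (M k j)))) ⟩
    sum (λ j → sum (λ k → A i k × (M k j × x ^ toℕ j)))
      ≈⟨ ∑-comm (λ j k → A i k × (M k j × x ^ toℕ j)) ⟩
    sum (λ k → sum (λ j → A i k × (M k j × x ^ toℕ j)))
      ≈⟨ sum-cong-≋ (λ k → sym (×-distrib-sum (A i k) (λ j → M k j × x ^ toℕ j))) ⟩
    sum (λ k → A i k × row (M k) x) ∎

  module _ (U V : Carrier) where

    shiftedTerm : ℕ → ℕ → ℕ → Carrier
    shiftedTerm N i m = (i C (N ∸ suc m)) × (U ^ m * V ^ (N ∸ suc m))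

    shiftedBinomial : ℕ → ℕ → Carrier
    shiftedBinomial N i = ∑[ m < N ] shiftedTerm N i (toℕ m)

    shiftedBinomial-diagonal : ∀ i → shiftedBinomial (suc i) i ≈ (U + V) ^ i
    shiftedBinomial-diagonal i = begin
      ∑[ m < suc i ] ((i C (i ∸ toℕ m)) × (U ^ toℕ m * V ^ (i ∸ toℕ m)))
        ≈⟨ sum-cong-≋ {suc i} (λ m → ×-congˡ {x = U ^ toℕ m * V ^ (i ∸ toℕ m)}
                                              (≡.sym (nCk≡nC[n∸k] (Fin.toℕ≤pred[n] m)))) ⟩
      ∑[ m < suc i ] ((i C toℕ m) × (U ^ toℕ m * V ^ (i ∸ toℕ m)))
        ≈⟨ Binomial.theorem i U V ⟨
      (U + V) ^ i ∎

    shiftedTerm-suc : ∀ N i m → shiftedTerm (suc N) i (suc m) ≈ U * shiftedTerm N i m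
    shiftedTerm-suc N i m = trans (×-congʳ (i C (N ∸ suc m)) (*-assoc U (U ^ m) (V ^ (N ∸ suc m))))
                                  (sym (×-comm-* (i C (N ∸ suc m)) U (U ^ m * V ^ (N ∸ suc m))))

    shiftedBinomial-suc : ∀ N i →
      shiftedBinomial (suc N) i ≈ (i C N) × (1# * V ^ N) + U * shiftedBinomial N i
    shiftedBinomial-suc N i = +-congˡ (begin
      ∑[ m < N ] shiftedTerm (suc N) i (suc (toℕ m))
        ≈⟨ sum-cong-≋ {N} (λ m → shiftedTerm-suc N i (toℕ m)) ⟩
      ∑[ m < N ] (U * shiftedTerm N i (toℕ m))
        ≈⟨ *-distribˡ-sum {N} U (λ m → shiftedTerm N i (toℕ m)) ⟨
      U * shiftedBinomial N i ∎)

    shiftedBinomial-+ : ∀ d i → shiftedBinomial (d ℕ.+ suc i) i ≈ (U + V) ^ i * U ^ d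
    shiftedBinomial-+ zero i = trans (shiftedBinomial-diagonal i) (sym (*-identityʳ _))
    shiftedBinomial-+ (suc d) i = begin
      shiftedBinomial (suc (d ℕ.+ suc i)) i
        ≈⟨ shiftedBinomial-suc (d ℕ.+ suc i) i ⟩
      (i C (d ℕ.+ suc i)) × (1# * V ^ (d ℕ.+ suc i)) + U * shiftedBinomial (d ℕ.+ suc i) i
        ≈⟨ +-cong (×-congˡ (k>n⇒nCk≡0 (ℕ.m≤n+m (suc i) d))) (*-congˡ (shiftedBinomial-+ d i)) ⟩
      0 × (1# * V ^ (d ℕ.+ suc i)) + U * ((U + V) ^ i * U ^ d)
        ≈⟨ +-cong (×-homo-0 (1# * V ^ (d ℕ.+ suc i))) (x∙yz≈y∙xz U ((U + V) ^ i) (U ^ d)) ⟩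
      0# + (U + V) ^ i * (U * U ^ d)
        ≈⟨ +-identityˡ ((U + V) ^ i * (U * U ^ d)) ⟩
      (U + V) ^ i * U ^ suc d ∎

    shiftedBinomial≈ : ∀ {N i} → i < N → shiftedBinomial N i ≈ (U + V) ^ i * U ^ (N ∸ suc i)
    shiftedBinomial≈ {N} {i} i<N =
      subst (λ M → shiftedBinomial M i ≈ (U + V) ^ i * U ^ (N ∸ suc i)) (ℕ.m∸n+n≡m i<N)
            (shiftedBinomial-+ (N ∸ suc i) i)

  row-Rmat⊗ : ∀ {n} (M : Mat n) x U V → (∀ k → row (M k) x ≈ U ^ toℕ k * V ^ (n ∸ suc (toℕ k))) →
              ∀ i → row ((Rmat n ⊗ M) i) x ≈ (U + V) ^ toℕ i * U ^ (n ∸ suc (toℕ i))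
  row-Rmat⊗ {n} M x U V rows i = begin
    row ((Rmat n ⊗ M) i) x
      ≈⟨ row-⊗ (Rmat n) M i x ⟩
    ∑[ k < n ] (Rmat n i k × row (M k) x)
      ≈⟨ sum-cong-≋ {n} (λ k → ×-congʳ (Rmat n i k) (rows k)) ⟩
    shiftedBinomial U V n (toℕ i)
      ≈⟨ shiftedBinomial≈ U V (Fin.toℕ<n i) ⟩
    (U + V) ^ toℕ i * U ^ (n ∸ suc (toℕ i)) ∎

  fibPoly : ℕ → Carrier → Carrier
  fibPoly e x = fib e × 1# + fib (suc e) × x

  -- F_{e-1} + F_e x, with F_{-1} = 1
  fibPolyPred : ℕ → Carrier → Carrier
  fibPolyPred zero x = 1#
  fibPolyPred (suc e) x = fibPoly e x

  fibPoly-step : ∀ e x → fibPoly e x + fibPolyPred e x ≈ fibPoly (suc e) x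
  -- 0 × 1# and 1 × x unfold to 0# and x + 0#.
  fibPoly-step zero x = trans (+-comm (0# + (x + 0#)) 1#) (sym (+-assoc 1# 0# (x + 0#)))
  fibPoly-step (suc e) x = begin
    (fib (suc e) × 1# + fib (2 ℕ.+ e) × x) + (fib e × 1# + fib (suc e) × x)
      ≈⟨ interchange (fib (suc e) × 1#) (fib (2 ℕ.+ e) × x) (fib e × 1#) (fib (suc e) × x) ⟩
    (fib (suc e) × 1# + fib e × 1#) + (fib (2 ℕ.+ e) × x + fib (suc e) × x)
      ≈⟨ +-cong (×-homo-+ 1# (fib (suc e)) (fib e)) (×-homo-+ x (fib (2 ℕ.+ e)) (fib (suc e))) ⟨
    fibPoly (2 ℕ.+ e) x ∎

  1#^ : ∀ m → 1# ^ m ≈ 1#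
  1#^ zero = refl
  1#^ (suc m) = trans (*-identityˡ (1# ^ m)) (1#^ m)

  row-idMat : ∀ {n} (i : Fin n) x → row (idMat i) x ≈ x ^ toℕ i
  row-idMat {n} i x = begin
    ∑[ j < n ] (idMat i j × x ^ toℕ j)
      ≈⟨ sum-concentrated +-monoid (λ j → idMat i j × x ^ toℕ j) i off ⟩
    idMat i i × x ^ toℕ i
      ≈⟨ ×-congˡ (idMat-diagonal i) ⟩
    1 × x ^ toℕ i
      ≈⟨ ×-homo-1 (x ^ toℕ i) ⟩
    x ^ toℕ i ∎
    where
    off : ∀ j → j ≢ i → idMat i j × x ^ toℕ j ≈ 0#
    off j j≢i = trans (×-congˡ (idMat-offDiagonal (j≢i ∘ ≡.sym))) (×-homo-0 (x ^ toℕ j))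

  row-matPow : ∀ {n} e x (i : Fin n) →
               row (matPow (Rmat n) e i) x ≈ fibPoly e x ^ toℕ i * fibPolyPred e x ^ (n ∸ suc (toℕ i))
  row-matPow {n} zero x i = begin
    row (idMat i) x
      ≈⟨ row-idMat i x ⟩
    x ^ toℕ i
      ≈⟨ *-identityʳ (x ^ toℕ i) ⟨
    x ^ toℕ i * 1#
      ≈⟨ *-cong (^-congˡ (toℕ i) fibPoly₀) (1#^ (n ∸ suc (toℕ i))) ⟨
    fibPoly 0 x ^ toℕ i * 1# ^ (n ∸ suc (toℕ i)) ∎
    where
    fibPoly₀ : fibPoly 0 x ≈ x
    fibPoly₀ = trans (+-identityˡ (x + 0#)) (+-identityʳ x)
  row-matPow {n} (suc e) x i =
    trans (row-Rmat⊗ (matPow (Rmat n) e) x (fibPoly e x) (fibPolyPred e x) (row-matPow e x) i)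
          (*-congʳ (^-congˡ (toℕ i) (fibPoly-step e x)))

sumFin≡sum : ∀ {n} (f : Fin n → ℕ) → sumFin f ≡ sumℕ f
sumFin≡sum {zero} f = ≡.refl
sumFin≡sum {suc n} f = ≡.cong (f Fin.zero ℕ.+_) (sumFin≡sum (f ∘ Fin.suc))

⊗-idMat : ∀ {n} (A : Mat n) i j → (A ⊗ idMat) i j ≡ A i j
⊗-idMat A i j = begin
  sumFin (λ k → A i k ℕ.* idMat k j)
    ≡⟨ sumFin≡sum (λ k → A i k ℕ.* idMat k j) ⟩
  sumℕ (λ k → A i k ℕ.* idMat k j)
    ≡⟨ sum-concentrated ℕ.+-0-monoid (λ k → A i k ℕ.* idMat k j) j off ⟩
  A i j ℕ.* idMat j j
    ≡⟨ ≡.cong (A i j ℕ.*_) (idMat-diagonal j) ⟩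
  A i j ℕ.* 1
    ≡⟨ ℕ.*-identityʳ (A i j) ⟩
  A i j ∎
  where
  open ≡.≡-Reasoning
  off : ∀ k → k ≢ j → A i k ℕ.* idMat k j ≡ 0
  off k k≢j = ≡.trans (≡.cong (A i k ℕ.*_) (idMat-offDiagonal k≢j)) (ℕ.*-zeroʳ (A i k))

-- Imported only from here on: these names clash with the structure fields opened above.
open import Data.Integer as ℤ using (ℤ)
import Data.Integer.Properties as ℤ
open import Data.Nat.Coprimality using (1-coprimeTo)
import Data.Nat.Coprimality as Coprime
open import Data.Rational as ℚ using (ℚ; mkℚ; 0ℚ; 1ℚ; _+_; _*_; _-_; -_)
import Data.Rational.Properties as ℚ
open import Data.List using (_∷_; map; applyUpTo; applyDownFrom; upTo; zipWith)
open import Data.List.Properties using (map-upTo)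
open import Data.Maybe using (just; nothing)
open import Level using (0ℓ)
import Tactic.RingSolver.Core.AlmostCommutativeRing as ACR
open import Tactic.RingSolver using (solve-∀)
open import Data.Product using (_×_; _,_)
open import Relation.Binary.PropositionalEquality

open import Algebra.Properties.CommutativeSemiring.Exp (CommutativeRing.commutativeSemiring ℚ.+-*-commutativeRing)
  using (_^_; ^-homo-*; ^-distrib-*)

-- Recognising 0ℚ lets the solver drop zero coefficients, so that the two normal forms coincide.
ℚ-ring : ACR.AlmostCommutativeRing 0ℓ 0ℓ
ℚ-ring = ACR.fromCommutativeRing ℚ.+-*-commutativeRing λ where
  (mkℚ (ℤ.+ 0) 0 _) → just refl
  _ → nothing

ℕ→ℚ-≡-mkℚ : ∀ n → ℕ→ℚ n ≡ mkℚ (ℤ.+ n) 0 (Coprime.sym (1-coprimeTo n))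
ℕ→ℚ-≡-mkℚ n = ℚ.normalize-coprime (Coprime.sym (1-coprimeTo n))

ℕ→ℚ-+ : ∀ m n → ℕ→ℚ (m ℕ.+ n) ≡ ℕ→ℚ m + ℕ→ℚ n
ℕ→ℚ-+ m n rewrite ℕ→ℚ-≡-mkℚ m | ℕ→ℚ-≡-mkℚ n | ℕ.*-identityʳ m | ℕ.*-identityʳ n
                | ℤ.+◃n≡+n m | ℤ.+◃n≡+n n = refl

ℕ→ℚ-suc≢0 : ∀ n → ℕ→ℚ (suc n) ≢ 0ℚ
ℕ→ℚ-suc≢0 n eq with trans (sym (ℕ→ℚ-≡-mkℚ (suc n))) eq
... | ()

*-recip : ∀ q → q ≢ 0ℚ → q * recip q ≡ 1ℚ
*-recip q q≢0 with q ℚ.≟ 0ℚ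
... | yes q≡0 = ⊥-elim (q≢0 q≡0)
... | no q≢0′ = ℚ.*-inverseʳ q {{ℚ.≢-nonZero q≢0′}}

*-recip-cancelˡ : ∀ {a} → a ≢ 0ℚ → ∀ x → a * (recip a * x) ≡ x
*-recip-cancelˡ {a} a≢0 x =
  trans (sym (ℚ.*-assoc a (recip a) x)) (trans (cong (_* x) (*-recip a a≢0)) (ℚ.*-identityˡ x))

*-≢0 : ∀ {x y} → x ≢ 0ℚ → y ≢ 0ℚ → x * y ≢ 0ℚ
*-≢0 {x} {y} x≢0 y≢0 xy≡0 = x≢0 (begin
  x                       ≡⟨ *-recip-cancelˡ y≢0 x ⟨
  y * (recip y * x)       ≡⟨ rearrange x y (recip y) ⟩
  recip y * (x * y)       ≡⟨ cong (recip y *_) xy≡0 ⟩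
  recip y * 0ℚ            ≡⟨ ℚ.*-zeroʳ (recip y) ⟩
  0ℚ                      ∎)
  where
  open ≡-Reasoning
  rearrange : ∀ x y r → y * (r * x) ≡ r * (x * y)
  rearrange = solve-∀ ℚ-ring

-‿≢0 : ∀ {x} → x ≢ 0ℚ → - x ≢ 0ℚ
-‿≢0 {x} x≢0 -x≡0 = x≢0 (ℚ.neg-injective -x≡0)

-- Formal power series

shift : Series → Series
shift f k = f (suc k)

⊛-suc : ∀ f g k → (f ⊛ g) (suc k) ≡ f 0 * g (suc k) + (shift f ⊛ g) k
⊛-suc f g k =
  cong sumℚ (trans (map-upTo (λ l → f l * g (suc k ∸ l)) (2 ℕ.+ k))
                   (cong (f 0 * g (suc k) ∷_) (sym (map-upTo (λ l → f (suc l) * g (k ∸ l)) (suc k)))))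

⊛-sucʳ : ∀ f g k → (f ⊛ g) (suc k) ≡ (f ⊛ shift g) k + f (suc k) * g 0
⊛-sucʳ f g zero rewrite ⊛-suc f g 0 = rearrange (f 0) (g 1) (f 1) (g 0)
  where
  rearrange : ∀ a b c d → a * b + (c * d + 0ℚ) ≡ (a * b + 0ℚ) + c * d
  rearrange = solve-∀ ℚ-ring
⊛-sucʳ f g (suc k) rewrite ⊛-suc f g (suc k) | ⊛-sucʳ (shift f) g k | ⊛-suc f (shift g) k =
  sym (ℚ.+-assoc (f 0 * g (2 ℕ.+ k)) ((shift f ⊛ shift g) k) (f (2 ℕ.+ k) * g 0))

⊛-cong : ∀ {f f′ g g′} → f ≈ₛ f′ → g ≈ₛ g′ → (f ⊛ g) ≈ₛ (f′ ⊛ g′)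
⊛-cong f≈f′ g≈g′ zero = cong (_+ 0ℚ) (cong₂ _*_ (f≈f′ 0) (g≈g′ 0))
⊛-cong {f} {f′} {g} {g′} f≈f′ g≈g′ (suc k) = begin
  (f ⊛ g) (suc k)                      ≡⟨ ⊛-suc f g k ⟩
  f 0 * g (suc k) + (shift f ⊛ g) k    ≡⟨ cong₂ _+_ (cong₂ _*_ (f≈f′ 0) (g≈g′ (suc k)))
                                                     (⊛-cong (f≈f′ ∘ suc) g≈g′ k) ⟩
  f′ 0 * g′ (suc k) + (shift f′ ⊛ g′) k ≡⟨ ⊛-suc f′ g′ k ⟨
  (f′ ⊛ g′) (suc k)                    ∎
  where open ≡-Reasoning

⊛-congˡ : ∀ f {g g′} → g ≈ₛ g′ → (f ⊛ g) ≈ₛ (f ⊛ g′)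
⊛-congˡ f = ⊛-cong {f} (λ _ → refl)

⊛-congʳ : ∀ h {f f′} → f ≈ₛ f′ → (f ⊛ h) ≈ₛ (f′ ⊛ h)
⊛-congʳ h f≈f′ = ⊛-cong {g = h} f≈f′ (λ _ → refl)

⊕-cong : ∀ {f f′ g g′} → f ≈ₛ f′ → g ≈ₛ g′ → (f ⊕ g) ≈ₛ (f′ ⊕ g′)
⊕-cong f≈f′ g≈g′ k = cong₂ _+_ (f≈f′ k) (g≈g′ k)

⊛-comm : ∀ f g → (f ⊛ g) ≈ₛ (g ⊛ f)
⊛-comm f g zero = cong (_+ 0ℚ) (ℚ.*-comm (f 0) (g 0))
⊛-comm f g (suc k) rewrite ⊛-suc f g k | ⊛-sucʳ g f k | ⊛-comm (shift f) g k =
  trans (ℚ.+-comm (f 0 * g (suc k)) ((g ⊛ shift f) k))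
        (cong ((g ⊛ shift f) k +_) (ℚ.*-comm (f 0) (g (suc k))))

⊛-distribʳ : ∀ h f g → ((f ⊕ g) ⊛ h) ≈ₛ (f ⊛ h ⊕ g ⊛ h)
⊛-distribʳ h f g zero = rearrange (f 0) (g 0) (h 0)
  where
  rearrange : ∀ a b c → (a + b) * c + 0ℚ ≡ (a * c + 0ℚ) + (b * c + 0ℚ)
  rearrange = solve-∀ ℚ-ring
⊛-distribʳ h f g (suc k)
  rewrite ⊛-suc (f ⊕ g) h k | ⊛-suc f h k | ⊛-suc g h k | ⊛-distribʳ h (shift f) (shift g) k =
  rearrange (f 0) (g 0) (h (suc k)) ((shift f ⊛ h) k) ((shift g ⊛ h) k)
  where
  rearrange : ∀ a b c x y → (a + b) * c + (x + y) ≡ (a * c + x) + (b * c + y)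
  rearrange = solve-∀ ℚ-ring

⊛-scaleˡ : ∀ c f g → (scaleS c f ⊛ g) ≈ₛ scaleS c (f ⊛ g)
⊛-scaleˡ c f g zero = rearrange c (f 0) (g 0)
  where
  rearrange : ∀ c a b → c * a * b + 0ℚ ≡ c * (a * b + 0ℚ)
  rearrange = solve-∀ ℚ-ring
⊛-scaleˡ c f g (suc k) rewrite ⊛-suc (scaleS c f) g k | ⊛-suc f g k | ⊛-scaleˡ c (shift f) g k =
  rearrange c (f 0) (g (suc k)) ((shift f ⊛ g) k)
  where
  rearrange : ∀ c a b x → c * a * b + c * x ≡ c * (a * b + x)
  rearrange = solve-∀ ℚ-ring

⊛-assoc : ∀ f g h → ((f ⊛ g) ⊛ h) ≈ₛ (f ⊛ (g ⊛ h))
⊛-assoc f g h zero = rearrange (f 0) (g 0) (h 0)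
  where
  rearrange : ∀ a b c → (a * b + 0ℚ) * c + 0ℚ ≡ a * (b * c + 0ℚ) + 0ℚ
  rearrange = solve-∀ ℚ-ring
⊛-assoc f g h (suc k) = begin
  ((f ⊛ g) ⊛ h) (suc k)
    ≡⟨ ⊛-suc (f ⊛ g) h k ⟩
  (f ⊛ g) 0 * h (suc k) + (shift (f ⊛ g) ⊛ h) k
    ≡⟨ cong ((f ⊛ g) 0 * h (suc k) +_) (⊛-congʳ h (⊛-suc f g) k) ⟩
  (f ⊛ g) 0 * h (suc k) + ((scaleS (f 0) (shift g) ⊕ (shift f ⊛ g)) ⊛ h) k
    ≡⟨ cong ((f ⊛ g) 0 * h (suc k) +_) (⊛-distribʳ h (scaleS (f 0) (shift g)) (shift f ⊛ g) k) ⟩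
  (f ⊛ g) 0 * h (suc k) + ((scaleS (f 0) (shift g) ⊛ h) k + ((shift f ⊛ g) ⊛ h) k)
    ≡⟨ cong₂ (λ u v → (f ⊛ g) 0 * h (suc k) + (u + v)) (⊛-scaleˡ (f 0) (shift g) h k)
                                                        (⊛-assoc (shift f) g h k) ⟩
  (f 0 * g 0 + 0ℚ) * h (suc k) + (f 0 * (shift g ⊛ h) k + (shift f ⊛ (g ⊛ h)) k)
    ≡⟨ rearrange (f 0) (g 0) (h (suc k)) ((shift g ⊛ h) k) ((shift f ⊛ (g ⊛ h)) k) ⟩
  f 0 * (g 0 * h (suc k) + (shift g ⊛ h) k) + (shift f ⊛ (g ⊛ h)) k
    ≡⟨ cong (λ u → f 0 * u + (shift f ⊛ (g ⊛ h)) k) (⊛-suc g h k) ⟨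
  f 0 * (g ⊛ h) (suc k) + (shift f ⊛ (g ⊛ h)) k
    ≡⟨ ⊛-suc f (g ⊛ h) k ⟨
  (f ⊛ (g ⊛ h)) (suc k) ∎
  where
  open ≡-Reasoning
  rearrange : ∀ a b c x y → (a * b + 0ℚ) * c + (a * x + y) ≡ a * (b * c + x) + y
  rearrange = solve-∀ ℚ-ring

zeroS-⊛ : ∀ f → (zeroS ⊛ f) ≈ₛ zeroS
zeroS-⊛ f zero = trans (ℚ.+-identityʳ _) (ℚ.*-zeroˡ (f 0))
zeroS-⊛ f (suc k) rewrite ⊛-suc zeroS f k | zeroS-⊛ f k =
  trans (ℚ.+-identityʳ _) (ℚ.*-zeroˡ (f (suc k)))

oneS-⊛ : ∀ f → (oneS ⊛ f) ≈ₛ f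
oneS-⊛ f zero = trans (ℚ.+-identityʳ _) (ℚ.*-identityˡ (f 0))
oneS-⊛ f (suc k) rewrite ⊛-suc oneS f k | zeroS-⊛ f k =
  trans (ℚ.+-identityʳ _) (ℚ.*-identityˡ (f (suc k)))

seriesRing : CommutativeRing 0ℓ 0ℓ
seriesRing = record
  { Carrier = Series
  ; _≈_ = _≈ₛ_
  ; _+_ = _⊕_
  ; _*_ = _⊛_
  ; -_ = λ f k → - f k
  ; 0# = zeroS
  ; 1# = oneS
  ; isCommutativeRing = record
    { isRing = record
      { +-isAbelianGroup = Pointwise.isAbelianGroup ℕ ℚ.+-0-isAbelianGroup
      ; *-cong = ⊛-cong
      ; *-assoc = ⊛-assoc
      ; *-identity = oneS-⊛ , λ f → λ k → trans (⊛-comm f oneS k) (oneS-⊛ f k)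
      ; distrib = (λ h f g k → trans (⊛-comm h (f ⊕ g) k) (trans (⊛-distribʳ h f g k)
                                  (cong₂ _+_ (⊛-comm f h k) (⊛-comm g h k))))
                , ⊛-distribʳ
      }
    ; *-comm = ⊛-comm
    }
  }

-- Products of series constants such as oneS ⊛ oneS do not compute, so identities between series
-- are normalised with natural-number coefficients.
open import Algebra.Solver.Ring.NaturalCoefficients.Default (CommutativeRing.commutativeSemiring seriesRing)
  using (con) renaming (solve to solveₛ; _:+_ to _:⊕_; _:*_ to _:⊛_; _:=_ to _:≈_)


open import Algebra.Properties.Semiring.Mult (CommutativeRing.semiring seriesRing) using ()
  renaming (_×_ to _×ₛ_)
open import Algebra.Properties.Semiring.Exp (CommutativeRing.semiring seriesRing) using ()
  renaming (_^_ to _^ₛ_; ^-congˡ to ^ₛ-congˡ)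
open import Algebra.Properties.CommutativeSemiring.Exp (CommutativeRing.commutativeSemiring seriesRing) using ()
  renaming (^-distrib-* to ^ₛ-distrib-*)
open import Algebra.Properties.Semiring.Sum (CommutativeRing.semiring seriesRing) using ()
  renaming (sum to sumₛ; sum-cong-≋ to sumₛ-cong)
open RowPolynomials (CommutativeRing.commutativeSemiring seriesRing) using (row; fibPoly; row-matPow)
open import Algebra.Properties.Monoid.Sum ℚ.+-0-monoid using () renaming (sum to ∑ℚ)

constS-⊛ : ∀ c f → (constS c ⊛ f) ≈ₛ scaleS c f
constS-⊛ c f zero = ℚ.+-identityʳ (c * f 0)
constS-⊛ c f (suc k) =
  trans (⊛-suc (constS c) f k) (trans (cong (c * f (suc k) +_) (zeroS-⊛ f k)) (ℚ.+-identityʳ (c * f (suc k))))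

constS-* : ∀ x y → constS (x * y) ≈ₛ (constS x ⊛ constS y)
constS-* x y zero = sym (constS-⊛ x (constS y) 0)
constS-* x y (suc k) = sym (trans (constS-⊛ x (constS y) (suc k)) (ℚ.*-zeroʳ x))

X : Series
X = monoS 1

X≈linS : X ≈ₛ linS 0ℚ 1ℚ
X≈linS zero = refl
X≈linS (suc zero) = refl
X≈linS (suc (suc k)) = refl

linS-⊛-zero : ∀ a b f → (linS a b ⊛ f) 0 ≡ a * f 0
linS-⊛-zero a b f = ℚ.+-identityʳ (a * f 0)

linS-⊛-suc : ∀ a b f k → (linS a b ⊛ f) (suc k) ≡ a * f (suc k) + b * f k
linS-⊛-suc a b f k =
  trans (⊛-suc (linS a b) f k) (cong (a * f (suc k) +_) (trans (⊛-congʳ f shift-linS k) (constS-⊛ b f k)))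
  where
  shift-linS : shift (linS a b) ≈ₛ constS b
  shift-linS zero = refl
  shift-linS (suc k) = refl

X-⊛-zero : ∀ f → (X ⊛ f) 0 ≡ 0ℚ
X-⊛-zero f = trans (ℚ.+-identityʳ (0ℚ * f 0)) (ℚ.*-zeroˡ (f 0))

X-⊛-suc : ∀ f k → (X ⊛ f) (suc k) ≡ f k
X-⊛-suc f k = begin
  (X ⊛ f) (suc k)                  ≡⟨ ⊛-congʳ f X≈linS (suc k) ⟩
  (linS 0ℚ 1ℚ ⊛ f) (suc k)         ≡⟨ linS-⊛-suc 0ℚ 1ℚ f k ⟩
  0ℚ * f (suc k) + 1ℚ * f k        ≡⟨ cong₂ _+_ (ℚ.*-zeroˡ (f (suc k))) (ℚ.*-identityˡ (f k)) ⟩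
  0ℚ + f k                         ≡⟨ ℚ.+-identityˡ (f k) ⟩
  f k                              ∎
  where open ≡-Reasoning

X-⊛-monoS : ∀ r → (X ⊛ monoS r) ≈ₛ monoS (suc r)
X-⊛-monoS r zero = X-⊛-zero (monoS r)
X-⊛-monoS r (suc k) = X-⊛-suc (monoS r) k

monoS≈X^ : ∀ m → monoS m ≈ₛ (X ^ₛ m)
monoS≈X^ zero k = refl
monoS≈X^ (suc m) k = trans (sym (X-⊛-monoS m k)) (⊛-congˡ X (monoS≈X^ m) k)

powS≡^ₛ : ∀ f m → powS f m ≡ f ^ₛ m
powS≡^ₛ f zero = refl
powS≡^ₛ f (suc m) = cong (f ⊛_) (powS≡^ₛ f m)

powS-cong : ∀ {f g} s → f ≈ₛ g → powS f s ≈ₛ powS g s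
powS-cong {f} {g} s f≈g rewrite powS≡^ₛ f s | powS≡^ₛ g s = ^ₛ-congˡ s f≈g

powS-⊛ : ∀ f g s → powS (f ⊛ g) s ≈ₛ (powS f s ⊛ powS g s)
powS-⊛ f g s rewrite powS≡^ₛ (f ⊛ g) s | powS≡^ₛ f s | powS≡^ₛ g s = ^ₛ-distrib-* f g s

sumFinS≡sumₛ : ∀ {n} (F : Fin n → Series) → sumFinS F ≡ sumₛ F
sumFinS≡sumₛ {zero} F = refl
sumFinS≡sumₛ {suc n} F = cong (F Fin.zero ⊕_) (sumFinS≡sumₛ (F ∘ Fin.suc))

scaleS-ℕ→ℚ : ∀ m f → scaleS (ℕ→ℚ m) f ≈ₛ (m ×ₛ f)
scaleS-ℕ→ℚ zero f k = ℚ.*-zeroˡ (f k)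
scaleS-ℕ→ℚ (suc m) f k =
  trans (cong (_* f k) (ℕ→ℚ-+ 1 m))
        (trans (rearrange (ℕ→ℚ m) (f k)) (cong (f k +_) (scaleS-ℕ→ℚ m f k)))
  where
  rearrange : ∀ q x → (1ℚ + q) * x ≡ x + q * x
  rearrange = solve-∀ ℚ-ring

linS≈ : ∀ a b → linS a b ≈ₛ (scaleS a oneS ⊕ scaleS b X)
linS≈ a b zero = rearrange a b
  where
  rearrange : ∀ a b → a ≡ a * 1ℚ + b * 0ℚ
  rearrange = solve-∀ ℚ-ring
linS≈ a b (suc zero) = rearrange a b
  where
  rearrange : ∀ a b → b ≡ a * 0ℚ + b * 1ℚ
  rearrange = solve-∀ ℚ-ring
linS≈ a b (suc (suc k)) = rearrange a b
  where
  rearrange : ∀ a b → 0ℚ ≡ a * 0ℚ + b * 0ℚ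
  rearrange = solve-∀ ℚ-ring

rowSeries : ∀ {n} → (Fin n → ℕ) → Series
rowSeries v = sumFinS (λ j → scaleS (ℕ→ℚ (v j)) (monoS (toℕ j)))

rowSeries≈row : ∀ {n} (v : Fin n → ℕ) → rowSeries v ≈ₛ row v X
rowSeries≈row {n} v k = begin
  rowSeries v k
    ≡⟨ cong (λ s → s k) (sumFinS≡sumₛ (λ j → scaleS (ℕ→ℚ (v j)) (monoS (toℕ j)))) ⟩
  sumₛ (λ j → scaleS (ℕ→ℚ (v j)) (monoS (toℕ j))) k
    ≡⟨ sumₛ-cong {n} (λ j k → trans (cong (ℕ→ℚ (v j) *_) (monoS≈X^ (toℕ j) k))
                                     (scaleS-ℕ→ℚ (v j) (X ^ₛ toℕ j) k)) k ⟩
  row v X k ∎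
  where open ≡-Reasoning

fibPoly≈linS : ∀ e → fibPoly e X ≈ₛ linS (ℕ→ℚ (fib e)) (ℕ→ℚ (fib (suc e)))
fibPoly≈linS e k = sym (trans (linS≈ (ℕ→ℚ (fib e)) (ℕ→ℚ (fib (suc e))) k)
                              (cong₂ _+_ (scaleS-ℕ→ℚ (fib e) oneS k) (scaleS-ℕ→ℚ (fib (suc e)) X k)))

rowSeries-matPow : ∀ n e (i : Fin n) →
  rowSeries (matPow (Rmat n) (suc e) i)
    ≈ₛ (powS (linS (ℕ→ℚ (fib (suc e))) (ℕ→ℚ (fib (2 ℕ.+ e)))) (toℕ i)
        ⊛ powS (linS (ℕ→ℚ (fib e)) (ℕ→ℚ (fib (suc e)))) (n ∸ suc (toℕ i)))
rowSeries-matPow n e i = begin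
  rowSeries (matPow (Rmat n) (suc e) i)
    ≈⟨ rowSeries≈row (matPow (Rmat n) (suc e) i) ⟩
  row (matPow (Rmat n) (suc e) i) X
    ≈⟨ row-matPow (suc e) X i ⟩
  fibPoly (suc e) X ^ₛ toℕ i ⊛ fibPoly e X ^ₛ (n ∸ suc (toℕ i))
    ≈⟨ ⊛-cong (^ₛ-congˡ (toℕ i) (fibPoly≈linS (suc e)))
              (^ₛ-congˡ (n ∸ suc (toℕ i)) (fibPoly≈linS e)) ⟩
  linS (ℕ→ℚ (fib (suc e))) (ℕ→ℚ (fib (2 ℕ.+ e))) ^ₛ toℕ i
    ⊛ linS (ℕ→ℚ (fib e)) (ℕ→ℚ (fib (suc e))) ^ₛ (n ∸ suc (toℕ i))
    ≡⟨ sym (cong₂ _⊛_ (powS≡^ₛ _ (toℕ i)) (powS≡^ₛ _ (n ∸ suc (toℕ i)))) ⟩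
  powS (linS (ℕ→ℚ (fib (suc e))) (ℕ→ℚ (fib (2 ℕ.+ e)))) (toℕ i)
    ⊛ powS (linS (ℕ→ℚ (fib e)) (ℕ→ℚ (fib (suc e)))) (n ∸ suc (toℕ i)) ∎
  where open import Relation.Binary.Reasoning.Setoid (CommutativeRing.setoid seriesRing)

monoS-diagonal : ∀ m → monoS m m ≡ 1ℚ
monoS-diagonal zero = refl
monoS-diagonal (suc m) = monoS-diagonal m

monoS-offDiagonal : ∀ {m k} → m ≢ k → monoS m k ≡ 0ℚ
monoS-offDiagonal {zero} {zero} 0≢0 = ⊥-elim (0≢0 refl)
monoS-offDiagonal {zero} {suc k} _ = refl
monoS-offDiagonal {suc m} {zero} _ = refl
monoS-offDiagonal {suc m} {suc k} m≢k = monoS-offDiagonal (m≢k ∘ cong suc)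

sumFinS-apply : ∀ {n} (F : Fin n → Series) k → sumFinS F k ≡ ∑ℚ (λ j → F j k)
sumFinS-apply {zero} F k = refl
sumFinS-apply {suc n} F k = cong (F Fin.zero k +_) (sumFinS-apply (F ∘ Fin.suc) k)

rowSeries-coefficient : ∀ {n} (v : Fin n → ℕ) j → rowSeries v (toℕ j) ≡ ℕ→ℚ (v j)
rowSeries-coefficient v j = begin
  rowSeries v (toℕ j)
    ≡⟨ sumFinS-apply (λ i → scaleS (ℕ→ℚ (v i)) (monoS (toℕ i))) (toℕ j) ⟩
  ∑ℚ (λ i → ℕ→ℚ (v i) * monoS (toℕ i) (toℕ j))
    ≡⟨ sum-concentrated ℚ.+-0-monoid (λ i → ℕ→ℚ (v i) * monoS (toℕ i) (toℕ j)) j off ⟩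
  ℕ→ℚ (v j) * monoS (toℕ j) (toℕ j)
    ≡⟨ cong (ℕ→ℚ (v j) *_) (monoS-diagonal (toℕ j)) ⟩
  ℕ→ℚ (v j) * 1ℚ
    ≡⟨ ℚ.*-identityʳ (ℕ→ℚ (v j)) ⟩
  ℕ→ℚ (v j) ∎
  where
  open ≡-Reasoning
  off : ∀ i → i ≢ j → ℕ→ℚ (v i) * monoS (toℕ i) (toℕ j) ≡ 0ℚ
  off i i≢j = trans (cong (ℕ→ℚ (v i) *_) (monoS-offDiagonal (i≢j ∘ Fin.toℕ-injective)))
                    (ℚ.*-zeroʳ (ℕ→ℚ (v i)))

-- Inverses of power series

invList≡ : ∀ f k → invList f k ≡ applyDownFrom (invS f) (suc k)
invList≡ f zero = refl
invList≡ f (suc k) = cong (invS f (suc k) ∷_) (invList≡ f k)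

zipWith-applyUpTo-applyDownFrom : ∀ (u v : ℕ → ℚ) k →
  zipWith _*_ (applyUpTo u (suc k)) (applyDownFrom v (suc k)) ≡ applyUpTo (λ l → u l * v (k ∸ l)) (suc k)
zipWith-applyUpTo-applyDownFrom u v zero = refl
zipWith-applyUpTo-applyDownFrom u v (suc k) =
  cong (u 0 * v (suc k) ∷_) (zipWith-applyUpTo-applyDownFrom (u ∘ suc) v k)

invS-suc : ∀ f k → invS f (suc k) ≡ - (recip (f 0) * (shift f ⊛ invS f) k)
invS-suc f k = cong (λ xs → - (recip (f 0) * sumℚ xs)) (begin
  zipWith _*_ (map (shift f) (upTo (suc k))) (invList f k)
    ≡⟨ cong₂ (zipWith _*_) (map-upTo (shift f) (suc k)) (invList≡ f k) ⟩
  zipWith _*_ (applyUpTo (shift f) (suc k)) (applyDownFrom (invS f) (suc k))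
    ≡⟨ zipWith-applyUpTo-applyDownFrom (shift f) (invS f) k ⟩
  applyUpTo (λ l → shift f l * invS f (k ∸ l)) (suc k)
    ≡⟨ map-upTo (λ l → shift f l * invS f (k ∸ l)) (suc k) ⟨
  map (λ l → shift f l * invS f (k ∸ l)) (upTo (suc k)) ∎)
  where open ≡-Reasoning

⊛-invS : ∀ f → f 0 ≢ 0ℚ → (f ⊛ invS f) ≈ₛ oneS
⊛-invS f f₀≢0 zero = trans (ℚ.+-identityʳ (f 0 * recip (f 0))) (*-recip (f 0) f₀≢0)
⊛-invS f f₀≢0 (suc k) = begin
  (f ⊛ invS f) (suc k)              ≡⟨ ⊛-suc f (invS f) k ⟩
  f 0 * invS f (suc k) + s          ≡⟨ cong (λ x → f 0 * x + s) (invS-suc f k) ⟩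
  f 0 * - (recip (f 0) * s) + s     ≡⟨ rearrange (f 0) (recip (f 0) * s) s ⟩
  - (f 0 * (recip (f 0) * s)) + s   ≡⟨ cong (λ x → - x + s) (*-recip-cancelˡ f₀≢0 s) ⟩
  - s + s                           ≡⟨ ℚ.+-inverseˡ s ⟩
  0ℚ                                ∎
  where
  open ≡-Reasoning
  s : ℚ
  s = (shift f ⊛ invS f) k
  rearrange : ∀ a x s → a * - x + s ≡ - (a * x) + s
  rearrange = solve-∀ ℚ-ring

⊛-invS-unique : ∀ f {g h} → f 0 ≢ 0ℚ → (f ⊛ g) ≈ₛ h → g ≈ₛ (invS f ⊛ h)
⊛-invS-unique f {g} {h} f₀≢0 fg≈h = begin
  g                       ≈⟨ oneS-⊛ g ⟨
  oneS ⊛ g                ≈⟨ ⊛-congʳ g (⊛-invS f f₀≢0) ⟨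
  (f ⊛ invS f) ⊛ g        ≈⟨ rearrange f (invS f) g ⟩
  invS f ⊛ (f ⊛ g)        ≈⟨ ⊛-congˡ (invS f) fg≈h ⟩
  invS f ⊛ h              ∎
  where
  open import Relation.Binary.Reasoning.Setoid (CommutativeRing.setoid seriesRing)
  rearrange : ∀ f y g → ((f ⊛ y) ⊛ g) ≈ₛ (y ⊛ (f ⊛ g))
  rearrange = solveₛ 3 (λ f y g → (f :⊛ y) :⊛ g :≈ y :⊛ (f :⊛ g)) (λ _ → refl)

powS-zero : ∀ f m → powS f m 0 ≡ f 0 ^ℚ m
powS-zero f zero = refl
powS-zero f (suc m) = trans (ℚ.+-identityʳ (f 0 * powS f m 0)) (cong (f 0 *_) (powS-zero f m))

1ℚ^ℚ : ∀ m → 1ℚ ^ℚ m ≡ 1ℚ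
1ℚ^ℚ zero = refl
1ℚ^ℚ (suc m) = trans (ℚ.*-identityˡ (1ℚ ^ℚ m)) (1ℚ^ℚ m)

-- The columns for e = 1

oneMinusX : Series
oneMinusX = linS 1ℚ (- 1ℚ)

binomialColumn : ℕ → Series
binomialColumn r k = ℕ→ℚ (k C r)

oneMinusX-⊛-binomialColumn₀ : (oneMinusX ⊛ binomialColumn 0) ≈ₛ oneS
oneMinusX-⊛-binomialColumn₀ zero = refl
oneMinusX-⊛-binomialColumn₀ (suc k) = linS-⊛-suc 1ℚ (- 1ℚ) (binomialColumn 0) k

oneMinusX-⊛-binomialColumn : ∀ r → (oneMinusX ⊛ binomialColumn (suc r)) ≈ₛ (X ⊛ binomialColumn r)
oneMinusX-⊛-binomialColumn r zero = trans (ℚ.+-identityʳ (1ℚ * 0ℚ)) (sym (X-⊛-zero (binomialColumn r)))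
oneMinusX-⊛-binomialColumn r (suc k) = begin
  (oneMinusX ⊛ binomialColumn (suc r)) (suc k)
    ≡⟨ linS-⊛-suc 1ℚ (- 1ℚ) (binomialColumn (suc r)) k ⟩
  1ℚ * ℕ→ℚ (suc k C suc r) + - 1ℚ * ℕ→ℚ (k C suc r)
    ≡⟨ cong (λ m → 1ℚ * m + - 1ℚ * ℕ→ℚ (k C suc r))
            (trans (cong ℕ→ℚ (sym (nCk+nC[k+1]≡[n+1]C[k+1] k r))) (ℕ→ℚ-+ (k C r) (k C suc r))) ⟩
  1ℚ * (ℕ→ℚ (k C r) + ℕ→ℚ (k C suc r)) + - 1ℚ * ℕ→ℚ (k C suc r)
    ≡⟨ rearrange (ℕ→ℚ (k C r)) (ℕ→ℚ (k C suc r)) ⟩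
  binomialColumn r k
    ≡⟨ X-⊛-suc (binomialColumn r) k ⟨
  (X ⊛ binomialColumn r) (suc k) ∎
  where
  open ≡-Reasoning
  rearrange : ∀ x y → 1ℚ * (x + y) + - 1ℚ * y ≡ x
  rearrange = solve-∀ ℚ-ring

binomialColumn-⊛ : ∀ r → (binomialColumn r ⊛ powS oneMinusX (suc r)) ≈ₛ monoS r
binomialColumn-⊛ zero = begin
  binomialColumn 0 ⊛ (oneMinusX ⊛ oneS)   ≈⟨ rearrange (binomialColumn 0) oneMinusX oneS ⟩
  (oneMinusX ⊛ binomialColumn 0) ⊛ oneS   ≈⟨ ⊛-congʳ oneS oneMinusX-⊛-binomialColumn₀ ⟩
  oneS ⊛ oneS                             ≈⟨ oneS-⊛ oneS ⟩
  oneS                                    ∎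
  where
  open import Relation.Binary.Reasoning.Setoid (CommutativeRing.setoid seriesRing)
  rearrange : ∀ c l p → (c ⊛ (l ⊛ p)) ≈ₛ ((l ⊛ c) ⊛ p)
  rearrange = solveₛ 3 (λ c l p → c :⊛ (l :⊛ p) :≈ (l :⊛ c) :⊛ p) (λ _ → refl)
binomialColumn-⊛ (suc r) = begin
  binomialColumn (suc r) ⊛ (oneMinusX ⊛ powS oneMinusX (suc r))
    ≈⟨ rearrange (binomialColumn (suc r)) oneMinusX (powS oneMinusX (suc r)) ⟩
  (oneMinusX ⊛ binomialColumn (suc r)) ⊛ powS oneMinusX (suc r)
    ≈⟨ ⊛-congʳ (powS oneMinusX (suc r)) (oneMinusX-⊛-binomialColumn r) ⟩
  (X ⊛ binomialColumn r) ⊛ powS oneMinusX (suc r)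
    ≈⟨ ⊛-assoc X (binomialColumn r) (powS oneMinusX (suc r)) ⟩
  X ⊛ (binomialColumn r ⊛ powS oneMinusX (suc r))
    ≈⟨ ⊛-congˡ X (binomialColumn-⊛ r) ⟩
  X ⊛ monoS r
    ≈⟨ X-⊛-monoS r ⟩
  monoS (suc r) ∎
  where
  open import Relation.Binary.Reasoning.Setoid (CommutativeRing.setoid seriesRing)
  rearrange : ∀ c l p → (c ⊛ (l ⊛ p)) ≈ₛ ((l ⊛ c) ⊛ p)
  rearrange = solveₛ 3 (λ c l p → c :⊛ (l :⊛ p) :≈ (l :⊛ c) :⊛ p) (λ _ → refl)

binomialColumn≈ : ∀ r → binomialColumn r ≈ₛ (invS (powS oneMinusX (suc r)) ⊛ monoS r)
binomialColumn≈ r = ⊛-invS-unique (powS oneMinusX (suc r)) constantTerm≢0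
  (λ k → trans (⊛-comm (powS oneMinusX (suc r)) (binomialColumn r) k) (binomialColumn-⊛ r k))
  where
  constantTerm≢0 : powS oneMinusX (suc r) 0 ≢ 0ℚ
  constantTerm≢0 eq =
    ℕ→ℚ-suc≢0 0 (trans (sym (1ℚ^ℚ (suc r))) (trans (sym (powS-zero oneMinusX (suc r))) eq))

powS-constS : ∀ q s → powS (constS q) s ≈ₛ constS (q ^ℚ s)
powS-constS q zero = λ _ → refl
powS-constS q (suc s) k = trans (⊛-congˡ (constS q) (powS-constS q s) k) (sym (constS-* q (q ^ℚ s) k))

^ℚ≡^ : ∀ x m → x ^ℚ m ≡ x ^ m
^ℚ≡^ x zero = refl
^ℚ≡^ x (suc m) = cong (x *_) (^ℚ≡^ x m)

^ℚ-+ : ∀ x m k → x ^ℚ (m ℕ.+ k) ≡ x ^ℚ m * x ^ℚ k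
^ℚ-+ x m k rewrite ^ℚ≡^ x (m ℕ.+ k) | ^ℚ≡^ x m | ^ℚ≡^ x k = ^-homo-* x m k

^ℚ-distrib-* : ∀ x y m → (x * y) ^ℚ m ≡ x ^ℚ m * y ^ℚ m
^ℚ-distrib-* x y m rewrite ^ℚ≡^ (x * y) m | ^ℚ≡^ x m | ^ℚ≡^ y m = ^-distrib-* x y m

-- The coefficients C(m,j) a^(m-j) b^j of (a + b x)^m

binomTerm : ℚ → ℚ → ℕ → ℕ → ℚ
binomTerm a b m j = ℕ→ℚ (m C j) * a ^ℚ (m ∸ j) * b ^ℚ j

binomTerm-absorb : ∀ a b m j →
  a * binomTerm a b m (suc j) ≡ ℕ→ℚ (m C suc j) * a ^ℚ (m ∸ j) * b ^ℚ suc j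
binomTerm-absorb a b m j with suc j ℕ.≤? m
... | yes j<m rewrite ℕ.+-∸-assoc 1 j<m =
  rearrange a (ℕ→ℚ (m C suc j)) (a ^ℚ (m ∸ suc j)) (b ^ℚ suc j)
  where
  rearrange : ∀ a x y z → a * (x * y * z) ≡ x * (a * y) * z
  rearrange = solve-∀ ℚ-ring
... | no j≮m rewrite k>n⇒nCk≡0 (ℕ.≰⇒> j≮m) =
  rearrange a (a ^ℚ (m ∸ suc j)) (a ^ℚ (m ∸ j)) (b ^ℚ suc j)
  where
  rearrange : ∀ a y y′ z → a * (0ℚ * y * z) ≡ 0ℚ * y′ * z
  rearrange = solve-∀ ℚ-ring

binomTerm-pascal : ∀ a b m j →
  a * binomTerm a b m (suc j) + b * binomTerm a b m j ≡ binomTerm a b (suc m) (suc j)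
binomTerm-pascal a b m j = begin
  a * binomTerm a b m (suc j) + b * binomTerm a b m j
    ≡⟨ cong (_+ b * binomTerm a b m j) (binomTerm-absorb a b m j) ⟩
  ℕ→ℚ (m C suc j) * a ^ℚ (m ∸ j) * b ^ℚ suc j + b * (ℕ→ℚ (m C j) * a ^ℚ (m ∸ j) * b ^ℚ j)
    ≡⟨ rearrange (ℕ→ℚ (m C suc j)) (ℕ→ℚ (m C j)) (a ^ℚ (m ∸ j)) b (b ^ℚ j) ⟩
  (ℕ→ℚ (m C j) + ℕ→ℚ (m C suc j)) * a ^ℚ (m ∸ j) * b ^ℚ suc j
    ≡⟨ cong (λ x → x * a ^ℚ (m ∸ j) * b ^ℚ suc j)
            (trans (sym (ℕ→ℚ-+ (m C j) (m C suc j))) (cong ℕ→ℚ (nCk+nC[k+1]≡[n+1]C[k+1] m j))) ⟩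
  binomTerm a b (suc m) (suc j) ∎
  where
  open ≡-Reasoning
  rearrange : ∀ x′ x y b z → x′ * y * (b * z) + b * (x * y * z) ≡ (x + x′) * y * (b * z)
  rearrange = solve-∀ ℚ-ring

powS-linS : ∀ a b m j → powS (linS a b) m j ≡ binomTerm a b m j
powS-linS a b zero zero = refl
powS-linS a b zero (suc j) = sym (trans (cong (_* b ^ℚ suc j) (ℚ.*-zeroˡ 1ℚ)) (ℚ.*-zeroˡ (b ^ℚ suc j)))
powS-linS a b (suc m) zero =
  trans (linS-⊛-zero a b (powS (linS a b) m)) (trans (cong (a *_) (powS-linS a b m 0)) (rearrange a (a ^ℚ m)))
  where
  rearrange : ∀ a x → a * (1ℚ * x * 1ℚ) ≡ 1ℚ * (a * x) * 1ℚ
  rearrange = solve-∀ ℚ-ring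
powS-linS a b (suc m) (suc j) = begin
  powS (linS a b) (suc m) (suc j)
    ≡⟨ linS-⊛-suc a b (powS (linS a b) m) j ⟩
  a * powS (linS a b) m (suc j) + b * powS (linS a b) m j
    ≡⟨ cong₂ (λ x y → a * x + b * y) (powS-linS a b m (suc j)) (powS-linS a b m j) ⟩
  a * binomTerm a b m (suc j) + b * binomTerm a b m j
    ≡⟨ binomTerm-pascal a b m j ⟩
  binomTerm a b (suc m) (suc j) ∎
  where open ≡-Reasoning

binomTerm-recip : ∀ {a} → a ≢ 0ℚ → ∀ b m s →
  ℕ→ℚ (m C s) * (a ^ℚ m * (recip a * b) ^ℚ s) ≡ binomTerm a b m s
binomTerm-recip {a} a≢0 b m s with s ℕ.≤? m
... | yes s≤m = begin
  ℕ→ℚ (m C s) * (a ^ℚ m * (recip a * b) ^ℚ s)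
    ≡⟨ cong (λ k → ℕ→ℚ (m C s) * (a ^ℚ k * (recip a * b) ^ℚ s)) (ℕ.m∸n+n≡m s≤m) ⟨
  ℕ→ℚ (m C s) * (a ^ℚ (m ∸ s ℕ.+ s) * (recip a * b) ^ℚ s)
    ≡⟨ cong₂ (λ x y → ℕ→ℚ (m C s) * (x * y)) (^ℚ-+ a (m ∸ s) s) (^ℚ-distrib-* (recip a) b s) ⟩
  ℕ→ℚ (m C s) * (a ^ℚ (m ∸ s) * a ^ℚ s * (recip a ^ℚ s * b ^ℚ s))
    ≡⟨ rearrange (ℕ→ℚ (m C s)) (a ^ℚ (m ∸ s)) (a ^ℚ s) (recip a ^ℚ s) (b ^ℚ s) ⟩
  (a ^ℚ s * recip a ^ℚ s) * binomTerm a b m s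
    ≡⟨ cong (_* binomTerm a b m s) (trans (sym (^ℚ-distrib-* a (recip a) s))
                                           (trans (cong (_^ℚ s) (*-recip a a≢0)) (1ℚ^ℚ s))) ⟩
  1ℚ * binomTerm a b m s
    ≡⟨ ℚ.*-identityˡ (binomTerm a b m s) ⟩
  binomTerm a b m s ∎
  where
  open ≡-Reasoning
  rearrange : ∀ C x u v y → C * (x * u * (v * y)) ≡ (u * v) * (C * x * y)
  rearrange = solve-∀ ℚ-ring
... | no s≰m rewrite k>n⇒nCk≡0 (ℕ.≰⇒> s≰m) =
  rearrange (a ^ℚ m * (recip a * b) ^ℚ s) (a ^ℚ (m ∸ s)) (b ^ℚ s)
  where
  rearrange : ∀ x y z → 0ℚ * x ≡ 0ℚ * y * z
  rearrange = solve-∀ ℚ-ring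

fib-suc>0 : ∀ m → 0 < fib (suc m)
fib-suc>0 zero = s≤s z≤n
fib-suc>0 (suc m) = ℕ.<-≤-trans (fib-suc>0 m) (ℕ.m≤m+n (fib (suc m)) (fib m))

ℕ→ℚ-fib-suc≢0 : ∀ m → ℕ→ℚ (fib (suc m)) ≢ 0ℚ
ℕ→ℚ-fib-suc≢0 m with fib (suc m) | fib-suc>0 m
... | suc p | _ = ℕ→ℚ-suc≢0 p

zpow-suc : ∀ q m k → zpow q (suc m) (suc k) ≡ zpow q m k
zpow-suc q m zero = refl
zpow-suc q m (suc k) = refl

-- The array for e ≥ 2

module FibonacciArray (n′ e′ : ℕ) where

  n e : ℕ
  n = suc n′
  e = 2 ℕ.+ e′

  a b c : ℚ
  a = ℕ→ℚ (fib (suc e′))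
  b = ℕ→ℚ (fib e)
  c = ℕ→ℚ (fib (suc e))

  a≢0 : a ≢ 0ℚ
  a≢0 = ℕ→ℚ-fib-suc≢0 e′

  -- 0-based: A i j is the entry a_{i+1,j+1} of the paper.
  A : ℕ → ℕ → ℚ
  A = arrRec n e

  zpow-step : ∀ m k → a * zpow a m (suc k) ≡ zpow a m k
  zpow-step zero zero = *-recip-cancelˡ a≢0 1ℚ
  zpow-step zero (suc k) = *-recip-cancelˡ a≢0 (recip a ^ℚ suc k)
  zpow-step (suc m) zero = refl
  zpow-step (suc m) (suc k) rewrite zpow-suc a m (suc k) | zpow-suc a m k = zpow-step m k

  A-firstColumn : ∀ k → A k 0 ≡ zpow a n (suc k) * b ^ℚ k
  A-firstColumn zero = rearrange (a ^ℚ n′)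
    where
    rearrange : ∀ x → 1ℚ * x * 1ℚ ≡ x * 1ℚ
    rearrange = solve-∀ ℚ-ring
  A-firstColumn (suc k) = refl

  A-firstColumn-step : ∀ k → a * A (suc k) 0 ≡ b * A k 0
  A-firstColumn-step k rewrite A-firstColumn k = begin
    a * (zpow a n (2 ℕ.+ k) * b ^ℚ suc k)   ≡⟨ rearrange a b (zpow a n (2 ℕ.+ k)) (b ^ℚ k) ⟩
    b * (a * zpow a n (2 ℕ.+ k) * b ^ℚ k)   ≡⟨ cong (λ z → b * (z * b ^ℚ k)) (zpow-step n (suc k)) ⟩
    b * (zpow a n (suc k) * b ^ℚ k)         ∎
    where
    open ≡-Reasoning
    rearrange : ∀ a b z x → a * (z * (b * x)) ≡ b * (a * z * x)
    rearrange = solve-∀ ℚ-ring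

  A-step : ∀ i j → a * A (suc i) (suc j) + b * A (suc i) j ≡ b * A i (suc j) + c * A i j
  A-step i j = begin
    a * A (suc i) (suc j) + b * A (suc i) j
      ≡⟨ cong (_+ b * A (suc i) j) (*-recip-cancelˡ a≢0 (b * A i (suc j) + c * A i j - b * A (suc i) j)) ⟩
    (b * A i (suc j) + c * A i j - b * A (suc i) j) + b * A (suc i) j
      ≡⟨ rearrange (b * A i (suc j) + c * A i j) (b * A (suc i) j) ⟩
    b * A i (suc j) + c * A i j ∎
    where
    open ≡-Reasoning
    rearrange : ∀ s t → (s - t) + t ≡ s
    rearrange = solve-∀ ℚ-ring

  P Q D N : Series
  P = linS b c
  Q = linS a b
  D = linS a (- b)
  N = linS (- b) c

  rowA : ℕ → Series
  rowA i j = A i j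

  columnA : ℕ → Series
  columnA j k = A k j

  Q-⊛-rowA : ∀ i → (Q ⊛ rowA (suc i)) ≈ₛ (P ⊛ rowA i)
  Q-⊛-rowA i zero = begin
    (Q ⊛ rowA (suc i)) 0 ≡⟨ linS-⊛-zero a b (rowA (suc i)) ⟩
    a * A (suc i) 0      ≡⟨ A-firstColumn-step i ⟩
    b * A i 0            ≡⟨ linS-⊛-zero b c (rowA i) ⟨
    (P ⊛ rowA i) 0       ∎
    where open ≡-Reasoning
  Q-⊛-rowA i (suc j) = begin
    (Q ⊛ rowA (suc i)) (suc j)                ≡⟨ linS-⊛-suc a b (rowA (suc i)) j ⟩
    a * A (suc i) (suc j) + b * A (suc i) j   ≡⟨ A-step i j ⟩
    b * A i (suc j) + c * A i j               ≡⟨ linS-⊛-suc b c (rowA i) j ⟨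
    (P ⊛ rowA i) (suc j)                      ∎
    where open ≡-Reasoning

  D-⊛-columnA₀ : (D ⊛ columnA 0) ≈ₛ constS (a ^ℚ n)
  D-⊛-columnA₀ zero = trans (linS-⊛-zero a (- b) (columnA 0)) (rearrange a (a ^ℚ n′))
    where
    rearrange : ∀ a x → a * (1ℚ * x * 1ℚ) ≡ a * x
    rearrange = solve-∀ ℚ-ring
  D-⊛-columnA₀ (suc k) = begin
    (D ⊛ columnA 0) (suc k)        ≡⟨ linS-⊛-suc a (- b) (columnA 0) k ⟩
    a * A (suc k) 0 + - b * A k 0  ≡⟨ cong (_+ - b * A k 0) (A-firstColumn-step k) ⟩
    b * A k 0 + - b * A k 0        ≡⟨ rearrange b (A k 0) ⟩
    0ℚ                             ∎
    where
    open ≡-Reasoning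
    rearrange : ∀ b x → b * x + - b * x ≡ 0ℚ
    rearrange = solve-∀ ℚ-ring

  D-⊛-columnA : ∀ j → (D ⊛ columnA (suc j)) ≈ₛ (N ⊛ columnA j ⊕ constS (binomTerm a b n (suc j)))
  D-⊛-columnA j zero = begin
    (D ⊛ columnA (suc j)) 0
      ≡⟨ linS-⊛-zero a (- b) (columnA (suc j)) ⟩
    a * binomTerm a b n′ (suc j)
      ≡⟨ rearrange a b (binomTerm a b n′ (suc j)) (binomTerm a b n′ j) ⟩
    - b * binomTerm a b n′ j + (a * binomTerm a b n′ (suc j) + b * binomTerm a b n′ j)
      ≡⟨ cong (- b * binomTerm a b n′ j +_) (binomTerm-pascal a b n′ j) ⟩
    - b * binomTerm a b n′ j + binomTerm a b n (suc j)
      ≡⟨ cong (_+ binomTerm a b n (suc j)) (linS-⊛-zero (- b) c (columnA j)) ⟨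
    (N ⊛ columnA j ⊕ constS (binomTerm a b n (suc j))) 0 ∎
    where
    open ≡-Reasoning
    rearrange : ∀ a b x y → a * x ≡ - b * y + (a * x + b * y)
    rearrange = solve-∀ ℚ-ring
  D-⊛-columnA j (suc k) = begin
    (D ⊛ columnA (suc j)) (suc k)
      ≡⟨ linS-⊛-suc a (- b) (columnA (suc j)) k ⟩
    a * A (suc k) (suc j) + - b * A k (suc j)
      ≡⟨ rearrange a b (A (suc k) (suc j)) (A (suc k) j) (A k (suc j)) ⟩
    (a * A (suc k) (suc j) + b * A (suc k) j) + - b * A (suc k) j + - b * A k (suc j)
      ≡⟨ cong (λ t → t + - b * A (suc k) j + - b * A k (suc j)) (A-step k j) ⟩
    (b * A k (suc j) + c * A k j) + - b * A (suc k) j + - b * A k (suc j)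
      ≡⟨ rearrange′ b c (A (suc k) j) (A k (suc j)) (A k j) ⟩
    (- b * A (suc k) j + c * A k j) + 0ℚ
      ≡⟨ cong (_+ 0ℚ) (linS-⊛-suc (- b) c (columnA j) k) ⟨
    (N ⊛ columnA j ⊕ constS (binomTerm a b n (suc j))) (suc k) ∎
    where
    open ≡-Reasoning
    rearrange : ∀ a b x y z → a * x + - b * z ≡ (a * x + b * y) + - b * y + - b * z
    rearrange = solve-∀ ℚ-ring
    rearrange′ : ∀ b c y z w → (b * z + c * w) + - b * y + - b * z ≡ (- b * y + c * w) + 0ℚ
    rearrange′ = solve-∀ ℚ-ring

  rowPower : ℕ → Series
  rowPower i = powS P i ⊛ powS Q (n′ ∸ i)

  Q-⊛-rowPower : ∀ {i} → suc i ≤ n′ → (Q ⊛ rowPower (suc i)) ≈ₛ (P ⊛ rowPower i)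
  Q-⊛-rowPower {i} i<n′ = begin
    Q ⊛ (P ⊛ powS P i ⊛ powS Q (n′ ∸ suc i))
      ≈⟨ rearrange Q P (powS P i) (powS Q (n′ ∸ suc i)) ⟩
    P ⊛ (powS P i ⊛ powS Q (suc (n′ ∸ suc i)))
      ≡⟨ cong (λ m → P ⊛ (powS P i ⊛ powS Q m)) (ℕ.+-∸-assoc 1 i<n′) ⟨
    P ⊛ rowPower i ∎
    where
    open import Relation.Binary.Reasoning.Setoid (CommutativeRing.setoid seriesRing)
    rearrange : ∀ q p pⁱ qᵐ → (q ⊛ (p ⊛ pⁱ ⊛ qᵐ)) ≈ₛ (p ⊛ (pⁱ ⊛ (q ⊛ qᵐ)))
    rearrange = solveₛ 4 (λ q p pⁱ qᵐ → q :⊛ ((p :⊛ pⁱ) :⊛ qᵐ) :≈ p :⊛ (pⁱ :⊛ (q :⊛ qᵐ)))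
                         (λ _ → refl)

  rowA≈rowPower : ∀ {i} → i ≤ n′ → rowA i ≈ₛ rowPower i
  rowA≈rowPower {zero} _ j = sym (trans (oneS-⊛ (powS Q n′) j) (powS-linS a b n′ j))
  rowA≈rowPower {suc i} i<n′ = begin
    rowA (suc i)                 ≈⟨ ⊛-invS-unique Q a≢0 (Q-⊛-rowA i) ⟩
    invS Q ⊛ (P ⊛ rowA i)        ≈⟨ ⊛-congˡ (invS Q) (⊛-congˡ P (rowA≈rowPower (ℕ.<⇒≤ i<n′))) ⟩
    invS Q ⊛ (P ⊛ rowPower i)    ≈⟨ ⊛-invS-unique Q a≢0 (Q-⊛-rowPower i<n′) ⟨
    rowPower (suc i)             ∎
    where open import Relation.Binary.Reasoning.Setoid (CommutativeRing.setoid seriesRing)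

  Y Z ratio W : Series
  Y = invS D
  Z = invS (scaleS a N)
  ratio = N ⊛ Y
  W = scaleS b D ⊛ Z

  closedForm : ℕ → Series
  closedForm j =
    powS ratio j ⊛ scaleS (a ^ℚ n) Y ⊛ (oneS ⊕ sumS1 j (λ s → scaleS (ℕ→ℚ (n C s)) (powS W s)))

  a-⊛-ratio-⊛-W : (constS a ⊛ (ratio ⊛ W)) ≈ₛ constS b
  a-⊛-ratio-⊛-W = begin
    constS a ⊛ ((N ⊛ Y) ⊛ (scaleS b D ⊛ Z))
      ≈⟨ ⊛-congˡ (constS a) (⊛-congˡ (N ⊛ Y) (⊛-congʳ Z (λ k → sym (constS-⊛ b D k)))) ⟩
    constS a ⊛ ((N ⊛ Y) ⊛ ((constS b ⊛ D) ⊛ Z))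
      ≈⟨ rearrange (constS a) (constS b) N Y D Z ⟩
    constS b ⊛ ((D ⊛ Y) ⊛ ((constS a ⊛ N) ⊛ Z))
      ≈⟨ ⊛-congˡ (constS b) (⊛-cong (⊛-invS D a≢0) aN⊛Z≈1) ⟩
    constS b ⊛ (oneS ⊛ oneS)
      ≈⟨ rearrange′ (constS b) ⟩
    constS b ∎
    where
    open import Relation.Binary.Reasoning.Setoid (CommutativeRing.setoid seriesRing)
    aN⊛Z≈1 : ((constS a ⊛ N) ⊛ Z) ≈ₛ oneS
    aN⊛Z≈1 k = trans (⊛-congʳ Z (constS-⊛ a N) k)
                     (⊛-invS (scaleS a N) (*-≢0 a≢0 (-‿≢0 (ℕ→ℚ-fib-suc≢0 (suc e′)))) k)
    rearrange : ∀ a b n y d z →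
                (a ⊛ ((n ⊛ y) ⊛ ((b ⊛ d) ⊛ z))) ≈ₛ (b ⊛ ((d ⊛ y) ⊛ ((a ⊛ n) ⊛ z)))
    rearrange = solveₛ 6 (λ a b n y d z → a :⊛ ((n :⊛ y) :⊛ ((b :⊛ d) :⊛ z))
                                          :≈ b :⊛ ((d :⊛ y) :⊛ ((a :⊛ n) :⊛ z)))
                         (λ _ → refl)
    rearrange′ : ∀ x → (x ⊛ (oneS ⊛ oneS)) ≈ₛ x
    rearrange′ = solveₛ 1 (λ x → x :⊛ (con 1 :⊛ con 1) :≈ x) (λ _ → refl)

  ratio-⊛-W : (ratio ⊛ W) ≈ₛ constS (recip a * b)
  ratio-⊛-W = begin
    ratio ⊛ W                                 ≈⟨ oneS-⊛ (ratio ⊛ W) ⟨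
    constS 1ℚ ⊛ (ratio ⊛ W)                   ≡⟨ cong (λ x → constS x ⊛ (ratio ⊛ W)) r*a≡1 ⟨
    constS (recip a * a) ⊛ (ratio ⊛ W)        ≈⟨ ⊛-congʳ (ratio ⊛ W) (constS-* (recip a) a) ⟩
    (constS (recip a) ⊛ constS a) ⊛ (ratio ⊛ W) ≈⟨ ⊛-assoc (constS (recip a)) (constS a) (ratio ⊛ W) ⟩
    constS (recip a) ⊛ (constS a ⊛ (ratio ⊛ W)) ≈⟨ ⊛-congˡ (constS (recip a)) a-⊛-ratio-⊛-W ⟩
    constS (recip a) ⊛ constS b               ≈⟨ constS-* (recip a) b ⟨
    constS (recip a * b)                      ∎
    where
    open import Relation.Binary.Reasoning.Setoid (CommutativeRing.setoid seriesRing)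
    r*a≡1 : recip a * a ≡ 1ℚ
    r*a≡1 = trans (ℚ.*-comm (recip a) a) (*-recip a a≢0)

  closedForm-term : ∀ s → (powS ratio s ⊛ scaleS (a ^ℚ n) Y ⊛ scaleS (ℕ→ℚ (n C s)) (powS W s))
                             ≈ₛ (Y ⊛ constS (binomTerm a b n s))
  closedForm-term s = begin
    powS ratio s ⊛ scaleS (a ^ℚ n) Y ⊛ scaleS (ℕ→ℚ (n C s)) (powS W s)
      ≈⟨ ⊛-cong (⊛-congˡ (powS ratio s) (sym ∘ constS-⊛ (a ^ℚ n) Y))
                (sym ∘ constS-⊛ (ℕ→ℚ (n C s)) (powS W s)) ⟩
    powS ratio s ⊛ (constS (a ^ℚ n) ⊛ Y) ⊛ (constS (ℕ→ℚ (n C s)) ⊛ powS W s)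
      ≈⟨ rearrange (powS ratio s) (constS (a ^ℚ n)) Y (constS (ℕ→ℚ (n C s))) (powS W s) ⟩
    Y ⊛ (constS (ℕ→ℚ (n C s)) ⊛ (constS (a ^ℚ n) ⊛ (powS ratio s ⊛ powS W s)))
      ≈⟨ ⊛-congˡ Y (⊛-congˡ (constS (ℕ→ℚ (n C s))) (⊛-congˡ (constS (a ^ℚ n)) (λ k →
           trans (sym (powS-⊛ ratio W s k))
                 (trans (powS-cong s ratio-⊛-W k) (powS-constS (recip a * b) s k))))) ⟩
    Y ⊛ (constS (ℕ→ℚ (n C s)) ⊛ (constS (a ^ℚ n) ⊛ constS ((recip a * b) ^ℚ s)))
      ≈⟨ ⊛-congˡ Y (λ k →
           trans (⊛-congˡ (constS (ℕ→ℚ (n C s))) (sym ∘ constS-* (a ^ℚ n) ((recip a * b) ^ℚ s)) k)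
                 (sym (constS-* (ℕ→ℚ (n C s)) (a ^ℚ n * (recip a * b) ^ℚ s) k))) ⟩
    Y ⊛ constS (ℕ→ℚ (n C s) * (a ^ℚ n * (recip a * b) ^ℚ s))
      ≡⟨ cong (λ x → Y ⊛ constS x) (binomTerm-recip a≢0 b n s) ⟩
    Y ⊛ constS (binomTerm a b n s) ∎
    where
    open import Relation.Binary.Reasoning.Setoid (CommutativeRing.setoid seriesRing)
    rearrange : ∀ p aⁿ y C w → (p ⊛ (aⁿ ⊛ y) ⊛ (C ⊛ w)) ≈ₛ (y ⊛ (C ⊛ (aⁿ ⊛ (p ⊛ w))))
    rearrange = solveₛ 5 (λ p aⁿ y C w → (p :⊛ (aⁿ :⊛ y)) :⊛ (C :⊛ w) :≈ y :⊛ (C :⊛ (aⁿ :⊛ (p :⊛ w))))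
                         (λ _ → refl)

  columnA≈closedForm : ∀ j → columnA j ≈ₛ closedForm j
  columnA≈closedForm zero = begin
    columnA 0                ≈⟨ ⊛-invS-unique D a≢0 D-⊛-columnA₀ ⟩
    Y ⊛ constS (a ^ℚ n)      ≈⟨ ⊛-comm Y (constS (a ^ℚ n)) ⟩
    constS (a ^ℚ n) ⊛ Y      ≈⟨ constS-⊛ (a ^ℚ n) Y ⟩
    scaleS (a ^ℚ n) Y        ≈⟨ rearrange (scaleS (a ^ℚ n) Y) ⟩
    closedForm 0             ∎
    where
    open import Relation.Binary.Reasoning.Setoid (CommutativeRing.setoid seriesRing)
    rearrange : ∀ x → x ≈ₛ ((oneS ⊛ x) ⊛ (oneS ⊕ zeroS))
    rearrange = solveₛ 1 (λ x → x :≈ (con 1 :⊛ x) :⊛ (con 1 :⊕ con 0)) (λ _ → refl)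
  columnA≈closedForm (suc j) = begin
    columnA (suc j)
      ≈⟨ ⊛-invS-unique D a≢0 (D-⊛-columnA j) ⟩
    Y ⊛ (N ⊛ columnA j ⊕ constS (binomTerm a b n (suc j)))
      ≈⟨ ⊛-congˡ Y (⊕-cong {g = constS (binomTerm a b n (suc j))}
                            (⊛-congˡ N (columnA≈closedForm j)) (λ _ → refl)) ⟩
    Y ⊛ (N ⊛ closedForm j ⊕ constS (binomTerm a b n (suc j)))
      ≈⟨ rearrange Y N (closedForm j) (constS (binomTerm a b n (suc j))) ⟩
    ratio ⊛ closedForm j ⊕ Y ⊛ constS (binomTerm a b n (suc j))
      ≈⟨ ⊕-cong {ratio ⊛ closedForm j} (λ _ → refl) (closedForm-term (suc j)) ⟨
    ratio ⊛ closedForm j ⊕ powS ratio (suc j) ⊛ scaleS (a ^ℚ n) Y ⊛ term (suc j)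
      ≈⟨ rearrange′ ratio (powS ratio j) (scaleS (a ^ℚ n) Y) (sumS1 j term) (term (suc j)) ⟨
    closedForm (suc j) ∎
    where
    open import Relation.Binary.Reasoning.Setoid (CommutativeRing.setoid seriesRing)
    term : ℕ → Series
    term s = scaleS (ℕ→ℚ (n C s)) (powS W s)
    rearrange : ∀ y n c k → (y ⊛ (n ⊛ c ⊕ k)) ≈ₛ ((n ⊛ y) ⊛ c ⊕ y ⊛ k)
    rearrange = solveₛ 4 (λ y n c k → y :⊛ (n :⊛ c :⊕ k) :≈ (n :⊛ y) :⊛ c :⊕ y :⊛ k)
                         (λ _ → refl)
    rearrange′ : ∀ r p A S t → ((r ⊛ p) ⊛ A ⊛ (oneS ⊕ (S ⊕ t)))
                               ≈ₛ (r ⊛ (p ⊛ A ⊛ (oneS ⊕ S)) ⊕ (r ⊛ p) ⊛ A ⊛ t)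
    rearrange′ = solveₛ 5 (λ r p A S t → ((r :⊛ p) :⊛ A) :⊛ (con 1 :⊕ (S :⊕ t))
                                          :≈ r :⊛ ((p :⊛ A) :⊛ (con 1 :⊕ S)) :⊕ ((r :⊛ p) :⊛ A) :⊛ t)
                          (λ _ → refl)

  A≡matPow : ∀ (i j : Fin n) → A (toℕ i) (toℕ j) ≡ ℕ→ℚ (matPow (Rmat n) e i j)
  A≡matPow i j = begin
    A (toℕ i) (toℕ j)                          ≡⟨ rowA≈rowPower (Fin.toℕ≤pred[n] i) (toℕ j) ⟩
    rowPower (toℕ i) (toℕ j)                   ≡⟨ rowSeries-matPow n (suc e′) i (toℕ j) ⟨
    rowSeries (matPow (Rmat n) e i) (toℕ j)    ≡⟨ rowSeries-coefficient (matPow (Rmat n) e i) j ⟩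
    ℕ→ℚ (matPow (Rmat n) e i j)                ∎
    where open ≡-Reasoning

arr≡matPow : ∀ n′ e (i j : Fin (suc n′)) →
  arr (suc n′) (suc e) (suc (toℕ i)) (suc (toℕ j)) ≡ ℕ→ℚ (matPow (Rmat (suc n′)) (suc e) i j)
arr≡matPow n′ zero i j = cong ℕ→ℚ (sym (⊗-idMat (Rmat (suc n′)) i j))
arr≡matPow n′ (suc e′) i j = FibonacciArray.A≡matPow n′ e′ i j

col₁≈ : ∀ n j → j ≤ n → col n 1 j ≈ₛ (invS (powS oneMinusX (suc n ∸ j)) ⊛ monoS (n ∸ j))
col₁≈ n j j≤n = subst (λ m → binomialColumn (n ∸ j) ≈ₛ (invS (powS oneMinusX m) ⊛ monoS (n ∸ j)))
                      (sym (ℕ.+-∸-assoc 1 j≤n)) (binomialColumn≈ (n ∸ j))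

mainTheorem1 : (n : ℕ) → 1 ≤ n →
  -- Part 1 and consistency, for every e ≥ 1
  ((e : ℕ) → 1 ≤ e →
    ((i : Fin n) →
      sumFinS (λ j → scaleS (ℕ→ℚ (matPow (Rmat n) e i j)) (monoS (toℕ j)))
        ≈ₛ (powS (linS (ℕ→ℚ (fib e)) (ℕ→ℚ (fib (suc e)))) (toℕ i)
            ⊛ powS (linS (ℕ→ℚ (fib (e ∸ 1))) (ℕ→ℚ (fib e))) (n ∸ suc (toℕ i))))
    × ((i j : Fin n) → arr n e (suc (toℕ i)) (suc (toℕ j)) ≡ ℕ→ℚ (matPow (Rmat n) e i j)))
  -- column generating functions for e = 1
  × ((j : ℕ) → 1 ≤ j → j ≤ n →
      col n 1 j ≈ₛ (invS (powS (linS 1ℚ (- 1ℚ)) (suc n ∸ j)) ⊛ monoS (n ∸ j)))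
  -- column generating functions for e ≥ 2
  × ((e : ℕ) → 2 ≤ e → (j : ℕ) → 1 ≤ j → j ≤ n →
      let a = ℕ→ℚ (fib (e ∸ 1))
          b = ℕ→ℚ (fib e)
          c = ℕ→ℚ (fib (suc e))
          D = linS a (- b)
          N = linS (- b) c
      in col n e j ≈ₛ
           (powS (N ⊛ invS D) (j ∸ 1)
            ⊛ scaleS (a ^ℚ n) (invS D)
            ⊛ (oneS ⊕ sumS1 (j ∸ 1)
                 (λ s → scaleS (ℕ→ℚ (n C s))
                          (powS (scaleS b D ⊛ invS (scaleS a N)) s)))))
mainTheorem1 (suc n′) _ =
  (λ { zero ()
     ; (suc e) _ → rowSeries-matPow (suc n′) e , arr≡matPow n′ e })
  , (λ j _ → col₁≈ (suc n′) j)
  , λ { (suc (suc e′)) _ (suc j) _ _ → FibonacciArray.columnA≈closedForm n′ e′ j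
      ; (suc (suc e′)) _ zero () _
      ; (suc zero) (s≤s ()) }
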